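{- Let $\Phi=(V,\mathscr{C})$ be a hypergraph with $V=[n]$, let $L\in\mathbb{N}$, $T:=n(L+1)$, and let $R_1,\dots,R_T$ be independent $\mathrm{Bern}(1/2)$ random variables. If $\lvert F(\Omega_\Phi;R_1,\dots,R_T)\rvert>1$, then the event $\mathscr{B}_L$ occurs when the variables $B_t$ are realized as $B_t:=R_t$ for $t\in[T]$.
   Context: A hypergraph $\Phi=(V,\mathscr{C})$ has finite vertex set $V=[n]=\{1,\dots,n\}$ and a collection $\mathscr{C}$ of nonempty subsets of $V$. We identify a set $S\subseteq V$ with its indicator $\sigma\in\{0,1\}^V$; $\sigma$ is an independent set if for every $C\in\mathscr{C}$ there is $v\in C$ with $\sigma(v)=0$. $\Omega_\Phi$ is the set of independent sets. For $\sigma\in\{0,1\}^V$, $v\in V$, $r\in\{0,1\}$, $\sigma^{v\gets r}$ is $\sigma$ with the value at $v$ replaced by $r$. Define $f(\sigma;v,r):=\sigma^{v\gets r}$ if $\sigma^{v\gets r}\in\Omega_\Phi$, and $f(\sigma;v,r):=\sigma$ otherwise. The scan sequence is $v_i:=(i\bmod n)+1$ for integers $i$. Set $F(\sigma;r_1,\dots,r_t):=f(f(\cdots f(\sigma;v_1,r_1)\cdots);v_t,r_t)$ and $F(S;r_1,\dots,r_t):=\{F(\sigma;r_1,\dots,r_t):\sigma\in S\}$. Witness graph: for $v\in V$ and integer $t$, $\mathrm{UpdTime}(v,t):=\max\{t^*\le t: v_{t^*}=v\}$. For $C\in\mathscr{C}$ and integer $t$, $e_{C,t}:=\{\mathrm{UpdTime}(v,t):v\in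 C\}$, a set of time points, with label $C(e_{C,t}):=C$. For $T\in\mathbb{N}$, the witness graph $H_T$ is the directed graph with vertex set $V_T:=\{e_{C,t}: t\in[T],\ C\in\mathscr{C},\ v_t\in C\}$ (vertices regarded as the pairs $(C,t)$) and a directed edge $e_{C,t}\to e_{C',t'}$ iff $t'<t$ and $e_{C,t}\cap e_{C',t'}\neq\emptyset$. An induced path of length $\ell$ is a sequence $(e_1,\dots,e_\ell)$ of distinct vertices such that $e_i\to e_{i+1}$ is an edge for each $i<\ell$ and there are no other edges of $H_T$ between vertices of the sequence. To each time point $t\in[T]$ attach a $\{0,1\}$-valued variable $B_t$ (independent $\mathrm{Bern}(1/2)$); a vertex $e$ is open if $B_t=1$ for all $t\in e$, and a set of vertices is open if all its members are open. For $L\in\mathbb{N}$ and $T=n(L+1)$, $\mathscr{B}_L$ is the event that $H_T$ contains an open induced path $(e_1,\dots,e_L)$ of length $L$ with $e_1\cap(T-n,T]\neq\emptyset$. -}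

module Defs where

open import Data.Nat as ℕ using (ℕ; zero; suc; NonZero; _*_; _∸_)
open import Data.Nat.DivMod using (_%_; m%n<n)
open import Data.Integer as ℤ using (ℤ; +_)
open import Data.Integer.DivMod using (_%ℕ_)
open import Data.Fin using (Fin; toℕ; fromℕ<)
open import Data.Fin.Properties using (any?)
open import Data.Bool using (Bool; true; false; _≟_)
open import Data.Vec using (Vec; lookup; _[_]≔_)
open import Data.List using (List)
open import Data.List.Relation.Unary.All using (All; all?)
open import Data.List.Membership.Propositional using (_∈_)
open import Data.Product using (Σ; ∃; ∃-syntax; _×_; _,_)
open import Relation.Nullary using (Dec; yes; no; ¬_)
open import Relation.Nullary.Decidable using (_×-dec_)
open import Relation.Binary.PropositionalEquality using (_≡_)

-- Vertex set V = [n] is represented by Fin n (Fin index i stands for vertex i+1).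
-- A subset of V / a configuration σ ∈ {0,1}^V is a Vec Bool n (true = 1).
Config : ℕ → Set
Config n = Vec Bool n

record Hypergraph (n : ℕ) : Set where
  field
    edges    : List (Vec Bool n)
    nonempty : All (λ C → ∃[ v ] lookup C v ≡ true) edges
open Hypergraph public

module _ {n : ℕ} (Φ : Hypergraph n) where

  Independent : Config n → Set
  Independent σ = All (λ C → ∃[ v ] (lookup C v ≡ true × lookup σ v ≡ false)) (edges Φ)

  independent? : (σ : Config n) → Dec (Independent σ)
  independent? σ = all? (λ C → any? (λ v → (lookup C v ≟ true) ×-dec (lookup σ v ≟ false))) (edges Φ)

  upd : Config n → Fin n → Bool → Config n
  upd σ v r with independent? (σ [ v ]≔ r)
  ... | yes _ = σ [ v ]≔ r
  ... | no  _ = σ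

  module _ .{{_ : NonZero n}} where

    -- scan sequence v_i = (i mod n) + 1, as a Fin n index (i mod n)
    scan : ℕ → Fin n
    scan i = fromℕ< (m%n<n i n)

    Fscan : Config n → (ℕ → Bool) → ℕ → Config n
    Fscan σ R zero    = σ
    Fscan σ R (suc t) = upd (Fscan σ R t) (scan (suc t)) (R (suc t))

    IsUpdTime : Fin n → ℤ → ℤ → Set
    IsUpdTime v t s =
      (s ℤ.≤ t) × (s %ℕ n ≡ toℕ v) ×
      (∀ s′ → s′ ℤ.≤ t → s′ %ℕ n ≡ toℕ v → s′ ℤ.≤ s)

    InE : Vec Bool n → ℕ → ℤ → Set
    InE C t s = ∃[ v ] (lookup C v ≡ true × IsUpdTime v (+ t) s)

    record WVertex (T : ℕ) : Set where
      constructor wv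
      field
        C     : Vec Bool n
        C∈𝒞   : C ∈ edges Φ
        t     : ℕ
        1≤t   : 1 ℕ.≤ t
        t≤T   : t ℕ.≤ T
        vt∈C  : lookup C (scan t) ≡ true
    open WVertex public

    Edge : {T : ℕ} → WVertex T → WVertex T → Set
    Edge x y = (t y ℕ.< t x) × ∃[ s ] (InE (C x) (t x) s × InE (C y) (t y) s)

    SameVertex : {T : ℕ} → WVertex T → WVertex T → Set
    SameVertex x y = (C x ≡ C y) × (t x ≡ t y)

    -- induced path (e_1, …, e_L), indexed by Fin L (index 0 is e_1)
    InducedPath : {T : ℕ} (L : ℕ) → (Fin L → WVertex T) → Set
    InducedPath L p =
      (∀ i j → SameVertex (p i) (p j) → i ≡ j) ×
      (∀ i j → toℕ j ≡ suc (toℕ i) → Edge (p i) (p j)) ×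
      (∀ i j → Edge (p i) (p j) → toℕ j ≡ suc (toℕ i))

    -- B_t := R_t for t ∈ [T]; a vertex e is open if B_t = 1 for all t ∈ e
    -- (time points outside [T] carry no variable and are treated as not open).
    Open : {T : ℕ} → (ℕ → Bool) → WVertex T → Set
    Open {T} R x = ∀ s → InE (C x) (t x) s →
      ∃[ u ] (s ≡ + u × 1 ℕ.≤ u × u ℕ.≤ T × R u ≡ true)

    EventB : (L : ℕ) → (ℕ → Bool) → Set
    EventB L R =
      let T = n * suc L in
      ∃[ p ] (InducedPath {T} L p × (∀ i → Open R (p i)) ×
              ∃[ i ] (toℕ i ≡ 0 × ∃[ s ] (InE (C (p i)) (t (p i)) s ×
                                          + (T ∸ n) ℤ.< s × s ℤ.≤ + T)))

-- Run the chains from σ and τ with the same randomness R. If they differ at time T at a site v,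
-- they already differ right after the last update t₀ > T − n of v. A disagreement created at a
-- step t means that one chain accepted a 1 at v_t (so R_t = 1) while the other rejected it,
-- because some C ∋ v_t has all its other sites occupied there; call (C, t) critical. By
-- independence C has a site w that is empty in the accepting chain, so the chains disagree at
-- w before t, hence right after the last update of w, which gives a critical (C′, t′) with
-- t − n < t′ < t sharing the time point UpdTime(w, t) with e_{C,t}: an edge of H_T. All time
-- points of a critical e_{C,t} carry R = 1, since each occupied site was last updated with
-- R = 1. Always stepping to the earliest critical out-neighbour yields an induced path, and
-- since a step loses less than n time units, starting from t₀ > nL it lasts for L vertices.

module Submission where

open import Defs
open import Data.Nat as ℕ using (ℕ; zero; suc; NonZero; _*_; _≤_; _<_; _+_; _∸_; z≤n; s≤s; s≤s⁻¹; _≤?_; _<?_)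
open import Data.Nat.Properties
open import Data.Nat.GeneralisedArithmetic using (fold)
open import Data.Nat.DivMod using (_%_; m%n<n; [m+n]%n≡m%n; m<n⇒m%n≡m)
open import Data.Integer as ℤ using (+_; -[1+_]; +≤+; -≤+; +<+)
import Data.Integer.Properties as ℤ
open import Data.Fin as Fin using (Fin; toℕ)
open import Data.Fin.Properties using (toℕ-fromℕ<; toℕ-injective; toℕ<n; any?; all?; ¬∀⟶∃¬)
open import Data.Bool as Bool using (Bool; true; false)
open import Data.Bool.Properties using (¬-not)
open import Data.Vec using (Vec; lookup; _[_]≔_)
open import Data.Vec.Properties using (lookup∘update; lookup∘update′; tabulate∘lookup; tabulate-cong)
open import Data.List.Membership.Propositional using (_∈_; find; lose)
import Data.List.Relation.Unary.All as All
open import Data.List.Relation.Unary.All.Properties using (¬All⇒Any¬)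
open import Data.List.Relation.Unary.Any as Any using (Any)
open import Data.Product using (Σ; ∃-syntax; _×_; _,_; proj₁; proj₂)
open import Data.Sum using (_⊎_; inj₁; inj₂; [_,_])
open import Data.Empty using (⊥)
open import Function using (_∘_)
open import Relation.Nullary using (Dec; yes; no; ¬_; contradiction)
open import Relation.Nullary.Decidable using (_×-dec_; _⊎-dec_; _→-dec_; ¬?)
open import Relation.Unary using (Pred; Decidable)
open import Relation.Binary.PropositionalEquality hiding ([_])
open import Relation.Binary.Definitions using (tri<; tri≈; tri>)

least-witness : ∀ {p} {P : Pred ℕ p} → Decidable P → ∀ {b} → P b →
                ∃[ m ] (P m × (∀ {j} → j < m → ¬ P j))
least-witness {P = P} P? {b} Pb with search (suc b)
  where
  search : ∀ c → (∀ {j} → j < c → ¬ P j) ⊎ ∃[ m ] (P m × (∀ {j} → j < m → ¬ P j))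
  search zero = inj₁ λ ()
  search (suc c) with search c
  ... | inj₂ found = inj₂ found
  ... | inj₁ none with P? c
  ...   | yes Pc = inj₂ (c , Pc , none)
  ...   | no ¬Pc = inj₁ λ j<1+c → [ none , (λ { refl → ¬Pc }) ] (m<1+n⇒m<n∨m≡n j<1+c)
... | inj₁ none  = contradiction Pb (none ≤-refl)
... | inj₂ found = found

lookup-≢ : ∀ {m} {xs ys : Vec Bool m} → xs ≢ ys → ∃[ i ] (lookup xs i ≢ lookup ys i)
lookup-≢ {m} {xs} {ys} xs≢ys = ¬∀⟶∃¬ m _ (λ i → lookup xs i Bool.≟ lookup ys i) λ same →
  xs≢ys (trans (sym (tabulate∘lookup xs)) (trans (tabulate-cong same) (tabulate∘lookup ys)))

module UpdateTime (n : ℕ) .{{_ : NonZero n}} where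

  -- Junk value 0 when no j ≤ K satisfies j % n ≡ v.
  updTime : ℕ → ℕ → ℕ
  updTime v zero = zero
  updTime v (suc K) with suc K % n ℕ.≟ v
  ... | yes _ = suc K
  ... | no  _ = updTime v K

  updTime-≤ : ∀ v K → updTime v K ≤ K
  updTime-≤ v zero = z≤n
  updTime-≤ v (suc K) with suc K % n ℕ.≟ v
  ... | yes _ = ≤-refl
  ... | no  _ = m≤n⇒m≤1+n (updTime-≤ v K)

  updTime-maximal : ∀ v K {j} → j ≤ K → j % n ≡ v → j ≤ updTime v K
  updTime-maximal v zero z≤n _ = z≤n
  updTime-maximal v (suc K) {j} j≤1+K j%n≡v with suc K % n ℕ.≟ v
  ... | yes _ = j≤1+K
  ... | no 1+K%n≢v with m≤n⇒m<n∨m≡n j≤1+K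
  ...   | inj₁ j<1+K = updTime-maximal v K (s≤s⁻¹ j<1+K) j%n≡v
  ...   | inj₂ refl  = contradiction j%n≡v 1+K%n≢v

  updTime-self : ∀ v m → m % n ≡ v → updTime v m ≡ m
  updTime-self v m m%n≡v = ≤-antisym (updTime-≤ v m) (updTime-maximal v m ≤-refl m%n≡v)

  updTime-skip : ∀ v K → suc K % n ≢ v → updTime v (suc K) ≡ updTime v K
  updTime-skip v K 1+K%n≢v with suc K % n ℕ.≟ v
  ... | yes 1+K%n≡v = contradiction 1+K%n≡v 1+K%n≢v
  ... | no  _       = refl

  updTime-% : ∀ v K → v < n → n ≤ suc K → updTime v K % n ≡ v
  updTime-% v K v<n n≤1+K = go K (s≤s⁻¹ (≤-trans v<n n≤1+K)) (m<n⇒m%n≡m v<n)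
    where
    go : ∀ K {j} → j ≤ K → j % n ≡ v → updTime v K % n ≡ v
    go zero z≤n j%n≡v = j%n≡v
    go (suc K) j≤1+K j%n≡v with suc K % n ℕ.≟ v
    ... | yes 1+K%n≡v = 1+K%n≡v
    ... | no 1+K%n≢v with m≤n⇒m<n∨m≡n j≤1+K
    ...   | inj₁ j<1+K = go K (s≤s⁻¹ j<1+K) j%n≡v
    ...   | inj₂ refl  = contradiction j%n≡v 1+K%n≢v

  updTime-recent : ∀ v K → v < n → n ≤ suc K → K < updTime v K + n
  updTime-recent v K v<n n≤1+K = ≰⇒> λ u+n≤K →
    <⇒≱ (m<m+n u (ℕ.>-nonZero⁻¹ n))
        (updTime-maximal v K u+n≤K (trans ([m+n]%n≡m%n u n) (updTime-% v K v<n n≤1+K)))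
    where
    u : ℕ
    u = updTime v K

  updTime-positive : ∀ v K → v < n → n ≤ K → 0 < updTime v K
  updTime-positive v K v<n n≤K with updTime v K in eq
  ... | suc _ = s≤s z≤n
  ... | zero  = contradiction (subst (λ u → K < u + n) eq (updTime-recent v K v<n (m≤n⇒m≤1+n n≤K)))
                            (≤⇒≯ n≤K)

module Updates {n : ℕ} (Φ : Hypergraph n) where

  upd-independent : ∀ {ζ} v r → Independent Φ ζ → Independent Φ (upd Φ ζ v r)
  upd-independent {ζ} v r Iζ with independent? Φ (ζ [ v ]≔ r)
  ... | yes Iζ′ = Iζ′
  ... | no  _   = Iζ

  upd-lookup-other : ∀ ζ v r {w} → w ≢ v → lookup (upd Φ ζ v r) w ≡ lookup ζ w
  upd-lookup-other ζ v r w≢v with independent? Φ (ζ [ v ]≔ r)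
  ... | yes _ = lookup∘update′ w≢v ζ r
  ... | no  _ = refl

  independent-[]≔false : ∀ {ζ} v → Independent Φ ζ → Independent Φ (ζ [ v ]≔ false)
  independent-[]≔false {ζ} v = All.map (λ {D} → free {D})
    where
    free : ∀ {D} → ∃[ w ] (lookup D w ≡ true × lookup ζ w ≡ false) →
           ∃[ w ] (lookup D w ≡ true × lookup (ζ [ v ]≔ false) w ≡ false)
    free (w , w∈D , ζw) with w Fin.≟ v
    ... | yes refl = w , w∈D , lookup∘update v ζ false
    ... | no  w≢v  = w , w∈D , trans (lookup∘update′ w≢v ζ false) ζw

  upd-true⇒true : ∀ {ζ} v r → Independent Φ ζ → lookup (upd Φ ζ v r) v ≡ true → r ≡ true
  upd-true⇒true v true  _  _ = refl
  upd-true⇒true {ζ} v false Iζ ζv with independent? Φ (ζ [ v ]≔ false)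
  ... | yes _   = contradiction (trans (sym ζv) (lookup∘update v ζ false)) λ ()
  ... | no ¬Iζ′ = contradiction (independent-[]≔false {ζ} v Iζ) ¬Iζ′

  upd-rejected : ∀ ζ v → lookup (upd Φ ζ v true) v ≡ false → ¬ Independent Φ (ζ [ v ]≔ true)
  upd-rejected ζ v ζv with independent? Φ (ζ [ v ]≔ true)
  ... | yes _   = λ _ → contradiction (trans (sym (lookup∘update v ζ true)) ζv) λ ()
  ... | no ¬Iζ′ = ¬Iζ′

  blocking-edge : ∀ {η} u → Independent Φ η → ¬ Independent Φ (η [ u ]≔ true) →
                  ∃[ C ] (C ∈ edges Φ × lookup C u ≡ true ×
                          (∀ {w} → lookup C w ≡ true → w ≢ u → lookup η w ≡ true))
  blocking-edge {η} u Iη ¬Iη′ with find (¬All⇒Any¬ unblocked? (edges Φ) ¬Iη′)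
    where
    η′ : Config n
    η′ = η [ u ]≔ true
    unblocked? : ∀ D → Dec (∃[ w ] (lookup D w ≡ true × lookup η′ w ≡ false))
    unblocked? D = any? λ w → (lookup D w Bool.≟ true) ×-dec (lookup η′ w Bool.≟ false)
  ... | D , D∈Φ , ¬unblocked = D , D∈Φ , u∈D , rest-true
    where
    rest-true : ∀ {w} → lookup D w ≡ true → w ≢ u → lookup η w ≡ true
    rest-true {w} w∈D w≢u =
      trans (sym (lookup∘update′ w≢u η true)) (¬-not λ η′w → ¬unblocked (w , w∈D , η′w))
    u∈D : lookup D u ≡ true
    u∈D with All.lookup Iη D∈Φ
    ... | w , w∈D , ηw with w Fin.≟ u
    ...   | yes refl = w∈D
    ...   | no  w≢u  = contradiction (trans (sym ηw) (rest-true w∈D w≢u)) λ ()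

module WitnessGraph {n : ℕ} .{{_ : NonZero n}} (Φ : Hypergraph n) where
  open UpdateTime n

  toℕ-scan : ∀ t → toℕ (scan Φ t) ≡ t % n
  toℕ-scan t = toℕ-fromℕ< (m%n<n t n)

  scan-% : ∀ t {w} → t % n ≡ toℕ w → scan Φ t ≡ w
  scan-% t t%n≡w = toℕ-injective (trans (toℕ-scan t) t%n≡w)

  updTime-scan : ∀ t → updTime (toℕ (scan Φ t)) t ≡ t
  updTime-scan t = updTime-self _ t (sym (toℕ-scan t))

  scan-updTime : ∀ w K → n ≤ suc K → scan Φ (updTime (toℕ w) K) ≡ w
  scan-updTime w K n≤1+K = scan-% _ (updTime-% (toℕ w) K (toℕ<n w) n≤1+K)

  updTime-IsUpdTime : ∀ v K → n ≤ suc K → IsUpdTime Φ v (+ K) (+ updTime (toℕ v) K)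
  updTime-IsUpdTime v K n≤1+K = +≤+ (updTime-≤ (toℕ v) K) , updTime-% (toℕ v) K (toℕ<n v) n≤1+K , maximal
    where
    maximal : ∀ s → s ℤ.≤ + K → s ℤ.%ℕ n ≡ toℕ v → s ℤ.≤ + updTime (toℕ v) K
    maximal (+ j)    (+≤+ j≤K) j%n≡v = +≤+ (updTime-maximal (toℕ v) K j≤K j%n≡v)
    maximal -[1+ _ ] _         _     = -≤+

  IsUpdTime-unique : ∀ {v t s₁ s₂} → IsUpdTime Φ v t s₁ → IsUpdTime Φ v t s₂ → s₁ ≡ s₂
  IsUpdTime-unique (s₁≤t , s₁%n , max₁) (s₂≤t , s₂%n , max₂) =
    ℤ.≤-antisym (max₂ _ s₁≤t s₁%n) (max₁ _ s₂≤t s₂%n)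

  InE⇒updTime : ∀ {C t s} → n ≤ suc t → InE Φ C t s →
                ∃[ v ] (lookup C v ≡ true × s ≡ + updTime (toℕ v) t)
  InE⇒updTime {t = t} n≤1+t (v , v∈C , isUpd) = v , v∈C , IsUpdTime-unique isUpd (updTime-IsUpdTime v t n≤1+t)

  updTime-InE : ∀ {C} t {v} → n ≤ suc t → lookup C v ≡ true → InE Φ C t (+ updTime (toℕ v) t)
  updTime-InE t {v} n≤1+t v∈C = v , v∈C , updTime-IsUpdTime v t n≤1+t

  InE-t : ∀ {T} (x : WVertex Φ T) → n ≤ t x → InE Φ (C x) (t x) (+ t x)
  InE-t x n≤x = subst (InE Φ (C x) (t x) ∘ +_) (updTime-scan (t x)) (updTime-InE {C x} (t x) (m≤n⇒m≤1+n n≤x) (vt∈C x))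

  SharesUpdate : Vec Bool n → ℕ → Vec Bool n → ℕ → Set
  SharesUpdate C t D t′ =
    ∃[ v ] ∃[ v′ ] (lookup C v ≡ true × lookup D v′ ≡ true × updTime (toℕ v) t ≡ updTime (toℕ v′) t′)

  SharesUpdate? : ∀ C t D t′ → Dec (SharesUpdate C t D t′)
  SharesUpdate? C t D t′ = any? λ v → any? λ v′ →
    (lookup C v Bool.≟ true) ×-dec (lookup D v′ Bool.≟ true) ×-dec (updTime (toℕ v) t ℕ.≟ updTime (toℕ v′) t′)

  module _ {T : ℕ} (x y : WVertex Φ T) (n≤x : n ≤ t x) (n≤y : n ≤ t y) where

    Edge⇒SharesUpdate : Edge Φ x y → SharesUpdate (C x) (t x) (C y) (t y)
    Edge⇒SharesUpdate (_ , s , s∈x , s∈y)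
      with InE⇒updTime {C x} (m≤n⇒m≤1+n n≤x) s∈x | InE⇒updTime {C y} (m≤n⇒m≤1+n n≤y) s∈y
    ... | v , v∈x , refl | v′ , v′∈y , s≡ = v , v′ , v∈x , v′∈y , ℤ.+-injective s≡

    SharesUpdate⇒Edge : t y < t x → SharesUpdate (C x) (t x) (C y) (t y) → Edge Φ x y
    SharesUpdate⇒Edge y<x (v , v′ , v∈x , v′∈y , shared) =
      y<x , _ , updTime-InE {C x} (t x) (m≤n⇒m≤1+n n≤x) v∈x ,
      subst (InE Φ (C y) (t y)) (cong +_ (sym shared)) (updTime-InE {C y} (t y) (m≤n⇒m≤1+n n≤y) v′∈y)

    Edge⇒recent : Edge Φ x y → t x < t y + n
    Edge⇒recent e with Edge⇒SharesUpdate e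
    ... | v , v′ , _ , _ , shared = begin-strict
      t x                          <⟨ updTime-recent (toℕ v) (t x) (toℕ<n v) (m≤n⇒m≤1+n n≤x) ⟩
      updTime (toℕ v) (t x) + n    ≡⟨ cong (_+ n) shared ⟩
      updTime (toℕ v′) (t y) + n   ≤⟨ +-monoˡ-≤ n (updTime-≤ (toℕ v′) (t y)) ⟩
      t y + n                      ∎
      where open ≤-Reasoning

module Chains {n : ℕ} .{{_ : NonZero n}} (Φ : Hypergraph n) (R : ℕ → Bool) where
  open UpdateTime n
  open Updates Φ
  open WitnessGraph Φ

  run : Config n → ℕ → Config n
  run ζ = Fscan Φ ζ R

  run-independent : ∀ {ζ} → Independent Φ ζ → ∀ k → Independent Φ (run ζ k)
  run-independent Iζ zero    = Iζ
  run-independent Iζ (suc k) = upd-independent _ _ (run-independent Iζ k)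

  run-unchanged : ∀ ζ w {m} k → m ≤ k → (∀ {j} → m < j → j ≤ k → j % n ≢ toℕ w) →
                lookup (run ζ k) w ≡ lookup (run ζ m) w
  run-unchanged ζ w zero z≤n _ = refl
  run-unchanged ζ w (suc k) m≤1+k unscanned with m≤n⇒m<n∨m≡n m≤1+k
  ... | inj₂ refl  = refl
  ... | inj₁ m<1+k = trans (upd-lookup-other _ _ _ w≢scan)
                           (run-unchanged ζ w k (s≤s⁻¹ m<1+k) λ m<j j≤k → unscanned m<j (m≤n⇒m≤1+n j≤k))
    where
    w≢scan : w ≢ scan Φ (suc k)
    w≢scan refl = unscanned m<1+k ≤-refl (sym (toℕ-scan (suc k)))

  run-updTime : ∀ ζ w K → lookup (run ζ K) w ≡ lookup (run ζ (updTime (toℕ w) K)) w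
  run-updTime ζ w K = run-unchanged ζ w K (updTime-≤ (toℕ w) K)
    λ u<j j≤K j%n≡w → <⇒≱ u<j (updTime-maximal (toℕ w) K j≤K j%n≡w)

  R-at-updTime : ∀ {ζ} w K → Independent Φ ζ → n ≤ K → lookup (run ζ K) w ≡ true →
                 R (updTime (toℕ w) K) ≡ true
  R-at-updTime {ζ} w K Iζ n≤K ζw = go (updTime (toℕ w) K) refl
    where
    go : ∀ t → updTime (toℕ w) K ≡ t → R t ≡ true
    go zero    u≡0 = contradiction (subst (0 <_) u≡0 (updTime-positive (toℕ w) K (toℕ<n w) n≤K)) λ ()
    go (suc m) u≡t = upd-true⇒true _ (R (suc m)) (run-independent Iζ m) (begin
      lookup (run ζ (suc m)) (scan Φ (suc m)) ≡⟨ cong (lookup (run ζ (suc m))) scan≡w ⟩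
      lookup (run ζ (suc m)) w                ≡⟨ cong (λ u → lookup (run ζ u) w) u≡t ⟨
      lookup (run ζ (updTime (toℕ w) K)) w    ≡⟨ run-updTime ζ w K ⟨
      lookup (run ζ K) w                      ≡⟨ ζw ⟩
      true                                    ∎)
      where
      open ≡-Reasoning
      scan≡w : scan Φ (suc m) ≡ w
      scan≡w = trans (cong (scan Φ) (sym u≡t)) (scan-updTime w K (m≤n⇒m≤1+n n≤K))

  Blocking : Config n → Config n → Vec Bool n → ℕ → Set
  Blocking ζ η C k =
    lookup (run ζ (suc k)) u ≡ true × lookup (run η (suc k)) u ≡ false ×
    (∀ w → lookup C w ≡ true → w ≢ u → lookup (run η k) w ≡ true)
    where
    u : Fin n
    u = scan Φ (suc k)

  Blocking? : ∀ ζ η C k → Dec (Blocking ζ η C k)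
  Blocking? ζ η C k =
    (lookup (run ζ (suc k)) u Bool.≟ true) ×-dec (lookup (run η (suc k)) u Bool.≟ false) ×-dec
    all? (λ w → (lookup C w Bool.≟ true) →-dec ¬? (w Fin.≟ u) →-dec (lookup (run η k) w Bool.≟ true))
    where
    u : Fin n
    u = scan Φ (suc k)

  module _ {ζ η : Config n} (Iζ : Independent Φ ζ) (Iη : Independent Φ η) where

    disagreement⇒blocking : ∀ k → let u = scan Φ (suc k) in
      lookup (run ζ (suc k)) u ≡ true → lookup (run η (suc k)) u ≡ false →
      ∃[ C ] (C ∈ edges Φ × lookup C u ≡ true × Blocking ζ η C k)
    disagreement⇒blocking k ζu ηu with blocking-edge {run η k} u (run-independent {η} Iη k) rejected
      where
      u : Fin n
      u = scan Φ (suc k)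
      R≡true : R (suc k) ≡ true
      R≡true = upd-true⇒true {run ζ k} u (R (suc k)) (run-independent {ζ} Iζ k) ζu
      rejected : ¬ Independent Φ (run η k [ u ]≔ true)
      rejected = upd-rejected (run η k) u (subst (λ r → lookup (upd Φ (run η k) u r) u ≡ false) R≡true ηu)
    ... | C , C∈Φ , u∈C , rest = C , C∈Φ , u∈C , ζu , ηu , λ _ → rest

    blocking⇒disagreement : ∀ {C} k → C ∈ edges Φ → Blocking ζ η C k →
      ∃[ w ] (lookup C w ≡ true × w ≢ scan Φ (suc k) ×
              lookup (run ζ k) w ≡ false × lookup (run η k) w ≡ true)
    blocking⇒disagreement k C∈Φ (ζu , _ , rest) with All.lookup (run-independent {ζ} Iζ (suc k)) C∈Φ
    ... | w , w∈C , ζw = w , w∈C , w≢u , trans (sym (upd-lookup-other _ _ _ w≢u)) ζw , rest w w∈C w≢u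
      where
      w≢u : w ≢ scan Φ (suc k)
      w≢u refl = contradiction (trans (sym ζu) ζw) λ ()

    blocking⇒R-at-updTime : ∀ {C} k → n ≤ suc k → Blocking ζ η C k →
      ∀ w → lookup C w ≡ true → R (updTime (toℕ w) (suc k)) ≡ true
    blocking⇒R-at-updTime k n≤1+k (ζu , _ , rest) w w∈C with w Fin.≟ scan Φ (suc k)
    ... | yes refl = R-at-updTime w (suc k) Iζ n≤1+k ζu
    ... | no  w≢u  = R-at-updTime w (suc k) Iη n≤1+k
                       (trans (upd-lookup-other _ _ _ w≢u) (rest w w∈C w≢u))

  module Coupling {σ τ : Config n} (Iσ : Independent Φ σ) (Iτ : Independent Φ τ) where

    Critical : Vec Bool n → ℕ → Set
    Critical C zero    = ⊥
    Critical C (suc k) = Blocking σ τ C k ⊎ Blocking τ σ C k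

    Critical? : ∀ C t → Dec (Critical C t)
    Critical? C zero    = no λ ()
    Critical? C (suc k) = Blocking? σ τ C k ⊎-dec Blocking? τ σ C k

    Disagree : ℕ → Fin n → Set
    Disagree k w = lookup (run σ k) w ≢ lookup (run τ k) w

    disagreement⇒critical : ∀ k → Disagree (suc k) (scan Φ (suc k)) →
      ∃[ C ] (C ∈ edges Φ × lookup C (scan Φ (suc k)) ≡ true × Critical C (suc k))
    disagreement⇒critical k σ≢τ with lookup (run σ (suc k)) u Bool.≟ true | lookup (run τ (suc k)) u Bool.≟ true
      where
      u : Fin n
      u = scan Φ (suc k)
    ... | yes σu | yes τu = contradiction (trans σu (sym τu)) σ≢τ
    ... | no  σu | no  τu = contradiction (trans (¬-not σu) (sym (¬-not τu))) σ≢τ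
    ... | yes σu | no  τu with disagreement⇒blocking Iσ Iτ k σu (¬-not τu)
    ...   | C , C∈Φ , u∈C , blocking = C , C∈Φ , u∈C , inj₁ blocking
    disagreement⇒critical k σ≢τ
        | no  σu | yes τu with disagreement⇒blocking Iτ Iσ k τu (¬-not σu)
    ...   | C , C∈Φ , u∈C , blocking = C , C∈Φ , u∈C , inj₂ blocking

    disagreement⇒critical-at-updTime : ∀ w K → n ≤ K → Disagree K w →
      ∃[ C ] (C ∈ edges Φ × lookup C w ≡ true × Critical C (updTime (toℕ w) K))
    disagreement⇒critical-at-updTime w K n≤K σ≢τ = go (updTime (toℕ w) K) refl
      where
      go : ∀ t → updTime (toℕ w) K ≡ t → ∃[ C ] (C ∈ edges Φ × lookup C w ≡ true × Critical C t)
      go zero    u≡0 = contradiction (subst (0 <_) u≡0 (updTime-positive (toℕ w) K (toℕ<n w) n≤K)) λ ()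
      go (suc m) u≡t = subst (λ v → ∃[ C ] (C ∈ edges Φ × lookup C v ≡ true × Critical C (suc m)))
                             scan≡w (disagreement⇒critical m disagree-at-t)
        where
        scan≡w : scan Φ (suc m) ≡ w
        scan≡w = trans (cong (scan Φ) (sym u≡t)) (scan-updTime w K (m≤n⇒m≤1+n n≤K))
        disagree-at-t : Disagree (suc m) (scan Φ (suc m))
        disagree-at-t = subst (Disagree (suc m)) (sym scan≡w) (subst (λ t → Disagree t w) u≡t
          λ eq → σ≢τ (trans (run-updTime σ w K) (trans eq (sym (run-updTime τ w K)))))

    critical⇒disagreement : ∀ {C} k → C ∈ edges Φ → Critical C (suc k) →
      ∃[ w ] (lookup C w ≡ true × w ≢ scan Φ (suc k) × Disagree k w)
    critical⇒disagreement k C∈Φ (inj₁ blocking) with blocking⇒disagreement Iσ Iτ k C∈Φ blocking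
    ... | w , w∈C , w≢u , σw , τw = w , w∈C , w≢u , λ eq → contradiction (trans (sym σw) (trans eq τw)) λ ()
    critical⇒disagreement k C∈Φ (inj₂ blocking) with blocking⇒disagreement Iτ Iσ k C∈Φ blocking
    ... | w , w∈C , w≢u , τw , σw = w , w∈C , w≢u , λ eq → contradiction (trans (sym σw) (trans eq τw)) λ ()

    critical⇒R-at-updTime : ∀ {C} t → n ≤ t → Critical C t →
      ∀ w → lookup C w ≡ true → R (updTime (toℕ w) t) ≡ true
    critical⇒R-at-updTime {C} (suc k) n≤t (inj₁ blocking) = blocking⇒R-at-updTime Iσ Iτ {C} k n≤t blocking
    critical⇒R-at-updTime {C} (suc k) n≤t (inj₂ blocking) = blocking⇒R-at-updTime Iτ Iσ {C} k n≤t blocking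

module CriticalPath {n : ℕ} .{{_ : NonZero n}} (Φ : Hypergraph n) (R : ℕ → Bool)
                    {σ τ : Config n} (Iσ : Independent Φ σ) (Iτ : Independent Φ τ) (T : ℕ) where
  open UpdateTime n
  open Chains Φ R
  open Coupling {σ} {τ} Iσ Iτ
  open WitnessGraph Φ

  Candidate : Vec Bool n → ℕ → ℕ → Set
  Candidate C t t′ = n ≤ t′ × t′ < t ×
    Any (λ D → lookup D (scan Φ t′) ≡ true × Critical D t′ × SharesUpdate C t D t′) (edges Φ)

  Candidate? : ∀ C t t′ → Dec (Candidate C t t′)
  Candidate? C t t′ = (n ≤? t′) ×-dec (t′ <? t) ×-dec
    Any.any? (λ D → (lookup D (scan Φ t′) Bool.≟ true) ×-dec Critical? D t′ ×-dec SharesUpdate? C t D t′) (edges Φ)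

  critical⇒candidate : ∀ {C} t → C ∈ edges Φ → Critical C t → n + n ≤ t → ∃[ t′ ] Candidate C t t′
  critical⇒candidate {C} (suc k) C∈Φ crit 2n≤1+k with critical⇒disagreement k C∈Φ crit
  ... | w , w∈C , w≢u , disagree with disagreement⇒critical-at-updTime w k n≤k disagree
    where
    n≤k : n ≤ k
    n≤k = s≤s⁻¹ (≤-trans (m<m+n n (ℕ.>-nonZero⁻¹ n)) 2n≤1+k)
  ... | D , D∈Φ , w∈D , critD = t′ , n≤t′ , s≤s (updTime-≤ (toℕ w) k) ,
        lose D∈Φ (subst (λ v → lookup D v ≡ true) (sym scan≡w) w∈D , critD , w , w , w∈C , w∈D , shared)
    where
    t′ : ℕ
    t′ = updTime (toℕ w) k
    n≤1+k : n ≤ suc k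
    n≤1+k = ≤-trans (m≤m+n n n) 2n≤1+k
    n≤t′ : n ≤ t′
    n≤t′ = +-cancelʳ-≤ n n t′ (≤-trans 2n≤1+k (updTime-recent (toℕ w) k (toℕ<n w) n≤1+k))
    scan≡w : scan Φ t′ ≡ w
    scan≡w = scan-updTime w k n≤1+k
    shared : updTime (toℕ w) (suc k) ≡ updTime (toℕ w) t′
    shared = begin
      updTime (toℕ w) (suc k) ≡⟨ updTime-skip (toℕ w) k (w≢u ∘ sym ∘ scan-% (suc k)) ⟩
      t′                      ≡⟨ updTime-self (toℕ w) t′ (updTime-% (toℕ w) k (toℕ<n w) n≤1+k) ⟨
      updTime (toℕ w) t′      ∎
      where open ≡-Reasoning

  -- n ≤ t guarantees that every site was scanned by time t, so e_{C,t} consists of times in [1, t].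
  Good : WVertex Φ T → Set
  Good x = n ≤ t x × Critical (C x) (t x)

  Good⇒Open : ∀ x → Good x → Open Φ R x
  Good⇒Open x (n≤x , crit) s s∈x with InE⇒updTime {C x} (m≤n⇒m≤1+n n≤x) s∈x
  ... | v , v∈x , refl = updTime (toℕ v) (t x) , refl ,
    updTime-positive (toℕ v) (t x) (toℕ<n v) n≤x ,
    ≤-trans (updTime-≤ (toℕ v) (t x)) (t≤T x) ,
    critical⇒R-at-updTime (t x) n≤x crit v v∈x

  Node : Set
  Node = Σ (WVertex Φ T) Good

  time : Node → ℕ
  time = t ∘ proj₁

  disagreement⇒Node : ∀ w → n ≤ updTime (toℕ w) T → Disagree T w →
                      ∃[ x ] time x ≡ updTime (toℕ w) T
  disagreement⇒Node w n≤t₀ disagree with disagreement⇒critical-at-updTime w T n≤T disagree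
    where
    n≤T : n ≤ T
    n≤T = ≤-trans n≤t₀ (updTime-≤ (toℕ w) T)
  ... | D , D∈Φ , w∈D , critD = (x₀ , n≤t₀ , critD) , refl
    where
    scan≡w : scan Φ (updTime (toℕ w) T) ≡ w
    scan≡w = scan-updTime w T (m≤n⇒m≤1+n (≤-trans n≤t₀ (updTime-≤ (toℕ w) T)))
    x₀ : WVertex Φ T
    x₀ = wv D D∈Φ (updTime (toℕ w) T) (≤-trans (ℕ.>-nonZero⁻¹ n) n≤t₀) (updTime-≤ (toℕ w) T)
            (subst (λ v → lookup D v ≡ true) (sym scan≡w) w∈D)

  record IsSuccessor (x y : Node) : Set where
    field
      edge     : Edge Φ (proj₁ x) (proj₁ y)
      recent   : time x < time y + n
      earliest : ∀ z → Good z → Edge Φ (proj₁ x) z → time y ≤ t z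

  successor : ∀ x → n + n ≤ time x → Σ Node (IsSuccessor x)
  successor x@(vx , n≤x , crit) 2n≤x
    with least-witness (Candidate? (C vx) (t vx)) (proj₂ (critical⇒candidate (t vx) (C∈𝒞 vx) crit 2n≤x))
  ... | t′ , (n≤t′ , t′<x , candidates) , earlier-none with find candidates
  ...   | D , D∈Φ , u∈D , critD , shared = (y , n≤t′ , critD) , record
    { edge     = x→y
    ; recent   = Edge⇒recent vx y n≤x n≤t′ x→y
    ; earliest = λ z (n≤z , critz) x→z → ≮⇒≥ λ z<y →
        earlier-none z<y (n≤z , proj₁ x→z , lose (C∈𝒞 z) (vt∈C z , critz , Edge⇒SharesUpdate vx z n≤x n≤z x→z))
    }
    where
    y : WVertex Φ T
    y = wv D D∈Φ t′ (≤-trans (ℕ.>-nonZero⁻¹ n) n≤t′) (≤-trans (<⇒≤ t′<x) (t≤T vx)) u∈D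
    x→y : Edge Φ vx y
    x→y = SharesUpdate⇒Edge vx y n≤x n≤t′ t′<x shared

  step : Node → Node
  step x with n + n ≤? time x
  ... | yes 2n≤x = proj₁ (successor x 2n≤x)
  ... | no  _    = x

  step-IsSuccessor : ∀ x → n + n ≤ time x → IsSuccessor x (step x)
  step-IsSuccessor x 2n≤x with n + n ≤? time x
  ... | yes 2n≤x′ = proj₂ (successor x 2n≤x′)
  ... | no  2n≰x  = contradiction 2n≤x 2n≰x

  step-≤ : ∀ x → time (step x) ≤ time x
  step-≤ x with n + n ≤? time x
  ... | yes 2n≤x = <⇒≤ (proj₁ (IsSuccessor.edge (proj₂ (successor x 2n≤x))))
  ... | no  _    = ≤-refl

  module Chain (L : ℕ) (x₀ : Node) (x₀-late : n * L < time x₀) where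

    node : ℕ → Node
    node = fold x₀ step

    timeAt : ℕ → ℕ
    timeAt = time ∘ node

    late⇒active : ∀ k → suc (suc k) ≤ L → n * L < timeAt k + n * k → n + n ≤ timeAt k
    late⇒active k 2+k≤L late = +-cancelʳ-≤ (n * k) (n + n) (timeAt k) (begin
      n + n + n * k       ≡⟨ +-assoc n n (n * k) ⟩
      n + (n + n * k)     ≡⟨ cong (λ m → n + m) (*-suc n k) ⟨
      n + n * suc k       ≡⟨ *-suc n (suc k) ⟨
      n * suc (suc k)     ≤⟨ *-monoʳ-≤ n 2+k≤L ⟩
      n * L               ≤⟨ <⇒≤ late ⟩
      timeAt k + n * k    ∎)
      where open ≤-Reasoning

    -- Each step loses less than n time units, while n * k units are budgeted for k steps.
    late : ∀ k → suc k ≤ L → n * L < timeAt k + n * k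
    late zero    _ = subst (n * L <_) (sym (trans (cong (λ m → time x₀ + m) (*-zeroʳ n)) (+-identityʳ _))) x₀-late
    late (suc k) 2+k≤L = begin-strict
      n * L                            <⟨ IH ⟩
      timeAt k + n * k                 <⟨ +-monoˡ-< (n * k) (IsSuccessor.recent (step-IsSuccessor (node k) active)) ⟩
      timeAt (suc k) + n + n * k       ≡⟨ +-assoc (timeAt (suc k)) n (n * k) ⟩
      timeAt (suc k) + (n + n * k)     ≡⟨ cong (λ m → timeAt (suc k) + m) (*-suc n k) ⟨
      timeAt (suc k) + n * suc k       ∎
      where
      open ≤-Reasoning
      IH : n * L < timeAt k + n * k
      IH = late k (≤-trans (n≤1+n _) 2+k≤L)
      active : n + n ≤ timeAt k
      active = late⇒active k 2+k≤L IH

    active : ∀ k → suc (suc k) ≤ L → n + n ≤ timeAt k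
    active k 2+k≤L = late⇒active k 2+k≤L (late k (≤-trans (n≤1+n _) 2+k≤L))

    node-IsSuccessor : ∀ k → suc (suc k) ≤ L → IsSuccessor (node k) (node (suc k))
    node-IsSuccessor k 2+k≤L = step-IsSuccessor (node k) (active k 2+k≤L)

    antitone : ∀ {i j} → i ≤ j → timeAt j ≤ timeAt i
    antitone {j = zero} z≤n = ≤-refl
    antitone {i} {suc j} i≤1+j with m≤n⇒m<n∨m≡n i≤1+j
    ... | inj₂ refl  = ≤-refl
    ... | inj₁ i<1+j = ≤-trans (step-≤ (node j)) (antitone (s≤s⁻¹ i<1+j))

    decreasing : ∀ {i j} → i < j → suc j ≤ L → timeAt j < timeAt i
    decreasing {i} {j} i<j 1+j≤L =
      ≤-<-trans (antitone i<j) (proj₁ (IsSuccessor.edge (node-IsSuccessor i (≤-trans (s≤s i<j) 1+j≤L))))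

    path : Fin L → WVertex Φ T
    path i = proj₁ (node (toℕ i))

    path-distinct : ∀ i j → SameVertex Φ (path i) (path j) → i ≡ j
    path-distinct i j (_ , same-time) with <-cmp (toℕ i) (toℕ j)
    ... | tri< i<j _ _ = contradiction (sym same-time) (<⇒≢ (decreasing i<j (toℕ<n j)))
    ... | tri≈ _ i≡j _ = toℕ-injective i≡j
    ... | tri> _ _ j<i = contradiction same-time (<⇒≢ (decreasing j<i (toℕ<n i)))

    path-consecutive : ∀ i j → toℕ j ≡ suc (toℕ i) → Edge Φ (path i) (path j)
    path-consecutive i j j≡1+i = subst (λ k → Edge Φ (path i) (proj₁ (node k))) (sym j≡1+i)
      (IsSuccessor.edge (node-IsSuccessor (toℕ i) (subst (λ k → suc k ≤ L) j≡1+i (toℕ<n j))))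

    path-only-consecutive : ∀ i j → Edge Φ (path i) (path j) → toℕ j ≡ suc (toℕ i)
    path-only-consecutive i j i→j with <-cmp (toℕ j) (suc (toℕ i))
    ... | tri≈ _ j≡1+i _ = j≡1+i
    ... | tri< j<1+i _ _ = contradiction (proj₁ i→j) (≤⇒≯ (antitone (s≤s⁻¹ j<1+i)))
    ... | tri> _ _ 1+i<j = contradiction
      (IsSuccessor.earliest (node-IsSuccessor (toℕ i) (≤-trans 1+i<j (<⇒≤ (toℕ<n j))))
                            (path j) (proj₂ (node (toℕ j))) i→j)
      (<⇒≱ (decreasing 1+i<j (toℕ<n j)))

    path-induced : InducedPath Φ L path
    path-induced = path-distinct , path-consecutive , path-only-consecutive

    path-open : ∀ i → Open Φ R (path i)
    path-open i = Good⇒Open (path i) (proj₂ (node (toℕ i)))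

lemma3p2 : (n : ℕ) .{{_ : NonZero n}} (Φ : Hypergraph n) (L : ℕ) → 1 ≤ L →
    (R : ℕ → Bool) →
    (∃[ σ ] ∃[ τ ] (Independent Φ σ × Independent Φ τ ×
       Fscan Φ σ R (n * suc L) ≢ Fscan Φ τ R (n * suc L))) →
    EventB Φ L R
lemma3p2 n Φ L@(suc _) _ R (σ , τ , Iσ , Iτ , F≢) =
  path , path-induced , path-open , Fin.zero , refl ,
  + time x₀ , InE-t (proj₁ x₀) (proj₁ (proj₂ x₀)) , +<+ T∸n<x₀ , +≤+ (t≤T (proj₁ x₀))
  where
  open UpdateTime n
  open WitnessGraph Φ
  T : ℕ
  T = n * suc L
  open CriticalPath Φ R {σ} {τ} Iσ Iτ T
  T≡nL+n : T ≡ n * L + n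
  T≡nL+n = trans (*-suc n L) (+-comm n (n * L))
  v : Fin n
  v = proj₁ (lookup-≢ F≢)
  nL<t₀ : n * L < updTime (toℕ v) T
  nL<t₀ = +-cancelʳ-< n (n * L) _ (subst (_< updTime (toℕ v) T + n) T≡nL+n
            (updTime-recent (toℕ v) T (toℕ<n v) (m≤n⇒m≤1+n (subst (n ≤_) (sym T≡nL+n) (m≤n+m n (n * L))))))
  start : ∃[ x ] time x ≡ updTime (toℕ v) T
  start = disagreement⇒Node v (≤-trans (m≤m*n n L) (<⇒≤ nL<t₀)) (proj₂ (lookup-≢ F≢))
  x₀ : Node
  x₀ = proj₁ start
  nL<x₀ : n * L < time x₀
  nL<x₀ = subst (n * L <_) (sym (proj₂ start)) nL<t₀
  T∸n<x₀ : T ∸ n < time x₀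
  T∸n<x₀ = subst (_< time x₀) (sym (trans (cong (_∸ n) T≡nL+n) (m+n∸n≡m (n * L) n))) nL<x₀
  open Chain L x₀ nL<x₀
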